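{- Let $n$ be a non-negative integer. Then, as polynomials in $x$, $$ \sum_{k=0}^{n}{ -x-1\choose k}^2{x\choose n-k}^2=\sum_{k=0}^{n}{n+k\choose 2k}{2k\choose k}^2{x+k\choose 2k}. $$
   Context: For a variable $x$ and a non-negative integer $k$, ${x\choose k}$ denotes the polynomial $x(x-1)\cdots(x-k+1)/k!$ (equal to $1$ for $k=0$); ${ -x-1\choose k}$ and ${x+k\choose 2k}$ denote this polynomial evaluated at $-x-1$ and $x+k$ respectively. For integers, ${a\choose b}$ is the usual binomial coefficient. -}

module Defs where

open import Data.Nat as ℕ using (ℕ; zero; suc; _!)
open import Data.Nat.Properties using (_!≢0)
open import Data.Integer as ℤ using (ℤ; +_)
open import Data.Rational using (ℚ; 0ℚ; 1ℚ; _+_; _*_; _-_; _/_; -_)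

ℕ→ℚ : ℕ → ℚ
ℕ→ℚ n = (+ n) / 1

fall : ℚ → ℕ → ℚ
fall x zero    = 1ℚ
fall x (suc k) = fall x k * (x - ℕ→ℚ k)

choose : ℚ → ℕ → ℚ
choose x k = fall x k * ((+ 1) / (k !)) {{k !≢0}}

Σ[0to_] : ℕ → (ℕ → ℚ) → ℚ
Σ[0to zero ] f = f zero
Σ[0to suc n ] f = Σ[0to n ] f + f (suc n)

{-# OPTIONS --safe #-}
module Submission where

-- Both sides, as sequences in n, are annihilated by the recurrence
--   (n+2)³ s(n+2) − (2n+3)(n² + 3n + 3 + 2x(x+1)) s(n+1) + (n+1)³ s(n) = 0.
-- For each side this is certified by creative telescoping: applied to the summand, the recurrence
-- gives a difference G(k+1) − G(k) of an explicit certificate that vanishes at both ends of the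
-- range, so the sums telescope to 0. The leading coefficient (n+2)³ never vanishes and the two
-- sides agree for n = 0 and n = 1, hence for all n. On the left the summand is first brought to
-- the form (x+k)_n² / (k! (n−k)!)², using (−x−1 choose k)² = (x+k choose k)².

open import Defs
open import Data.Nat using (ℕ; _∸_)
open import Data.Nat.Combinatorics using (_C_)
open import Data.Rational using (ℚ; 1ℚ; _+_; _*_; -_)
open import Relation.Binary.PropositionalEquality using (_≡_)

open import Data.Nat as ℕ using (zero; suc; _!; _≤_; _<_; _≤′_; ≤′-refl; ≤′-step; s≤s)
import Data.Nat.Properties as ℕₚ
open import Data.Nat.Properties using (_!≢0)
open import Data.Nat.Combinatorics using (nCk+nC[k+1]≡[n+1]C[k+1])
open import Data.Nat.Combinatorics.Specification using (k>n⇒nCk≡0)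
open import Data.Nat.Coprimality using (1-coprimeTo) renaming (sym to coprime-sym)
import Data.Integer as ℤ
import Data.Integer.Properties as ℤₚ
open import Data.Rational using (mkℚ; 0ℚ; _-_; _/_; 1/_)
import Data.Rational.Properties as ℚ
open import Data.Rational.Solver using (module +-*-Solver)
open +-*-Solver
open import Data.Product using (_×_; _,_; proj₁)
open import Data.Sum using (inj₁; inj₂)
open import Relation.Binary.PropositionalEquality using (refl; sym; trans; cong; cong₂; module ≡-Reasoning)
open ≡-Reasoning

ℕ→ℚ≡mkℚ : ∀ n → ℕ→ℚ n ≡ mkℚ (ℤ.+ n) 0 (coprime-sym (1-coprimeTo n))
ℕ→ℚ≡mkℚ n = ℚ.↥p/↧p≡p (mkℚ (ℤ.+ n) 0 (coprime-sym (1-coprimeTo n)))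

-- On normalised arguments, ℚ addition computes to the middle fraction.
ℕ→ℚ-suc : ∀ n → ℕ→ℚ (suc n) ≡ ℕ→ℚ n + 1ℚ
ℕ→ℚ-suc n = begin
  (ℤ.+ suc n) / 1                                    ≡⟨ ℚ./-cong numerator refl ⟩
  (ℤ.+ n ℤ.* ℤ.+ 1 ℤ.+ ℤ.+ 1 ℤ.* ℤ.+ 1) / (1 ℕ.* 1) ≡⟨ cong (_+ 1ℚ) (sym (ℕ→ℚ≡mkℚ n)) ⟩
  ℕ→ℚ n + 1ℚ                                         ∎
  where
  numerator : ℤ.+ suc n ≡ ℤ.+ n ℤ.* ℤ.+ 1 ℤ.+ ℤ.+ 1 ℤ.* ℤ.+ 1
  numerator = trans (cong ℤ.+_ (ℕₚ.+-comm 1 n)) (cong (ℤ._+ ℤ.+ 1) (sym (ℤₚ.*-identityʳ (ℤ.+ n))))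

ℕ→ℚ-+ : ∀ m n → ℕ→ℚ (m ℕ.+ n) ≡ ℕ→ℚ m + ℕ→ℚ n
ℕ→ℚ-+ zero n = sym (ℚ.+-identityˡ (ℕ→ℚ n))
ℕ→ℚ-+ (suc m) n = begin
  ℕ→ℚ (suc (m ℕ.+ n))     ≡⟨ ℕ→ℚ-suc (m ℕ.+ n) ⟩
  ℕ→ℚ (m ℕ.+ n) + 1ℚ      ≡⟨ cong (_+ 1ℚ) (ℕ→ℚ-+ m n) ⟩
  ℕ→ℚ m + ℕ→ℚ n + 1ℚ      ≡⟨ solve 2 (λ a b → a :+ b :+ con 1ℚ := a :+ con 1ℚ :+ b) refl (ℕ→ℚ m) (ℕ→ℚ n) ⟩
  ℕ→ℚ m + 1ℚ + ℕ→ℚ n      ≡⟨ cong (_+ ℕ→ℚ n) (sym (ℕ→ℚ-suc m)) ⟩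
  ℕ→ℚ (suc m) + ℕ→ℚ n     ∎

ℕ→ℚ-* : ∀ m n → ℕ→ℚ (m ℕ.* n) ≡ ℕ→ℚ m * ℕ→ℚ n
ℕ→ℚ-* zero n = sym (ℚ.*-zeroˡ (ℕ→ℚ n))
ℕ→ℚ-* (suc m) n = begin
  ℕ→ℚ (n ℕ.+ m ℕ.* n)     ≡⟨ ℕ→ℚ-+ n (m ℕ.* n) ⟩
  ℕ→ℚ n + ℕ→ℚ (m ℕ.* n)   ≡⟨ cong (λ z → ℕ→ℚ n + z) (ℕ→ℚ-* m n) ⟩
  ℕ→ℚ n + ℕ→ℚ m * ℕ→ℚ n   ≡⟨ solve 2 (λ a b → b :+ a :* b := (a :+ con 1ℚ) :* b) refl (ℕ→ℚ m) (ℕ→ℚ n) ⟩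
  (ℕ→ℚ m + 1ℚ) * ℕ→ℚ n    ≡⟨ cong (_* ℕ→ℚ n) (sym (ℕ→ℚ-suc m)) ⟩
  ℕ→ℚ (suc m) * ℕ→ℚ n     ∎

ℕ→ℚ-∸ : ∀ {k n} → k ≤ n → ℕ→ℚ (n ∸ k) ≡ ℕ→ℚ n - ℕ→ℚ k
ℕ→ℚ-∸ {k} {n} k≤n = begin
  D                             ≡⟨ solve 2 (λ K D → D := K :+ D :- K) refl (ℕ→ℚ k) D ⟩
  ℕ→ℚ k + D - ℕ→ℚ k             ≡⟨ cong (_- ℕ→ℚ k) (ℕ→ℚ-+ k (n ∸ k)) ⟨
  ℕ→ℚ (k ℕ.+ (n ∸ k)) - ℕ→ℚ k   ≡⟨ cong (λ m → ℕ→ℚ m - ℕ→ℚ k) (ℕₚ.m+[n∸m]≡n k≤n) ⟩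
  ℕ→ℚ n - ℕ→ℚ k                 ∎
  where D = ℕ→ℚ (n ∸ k)

+-ℕ→ℚ-suc : ∀ a k → a + ℕ→ℚ (suc k) ≡ a + ℕ→ℚ k + 1ℚ
+-ℕ→ℚ-suc a k = trans (cong (λ z → a + z) (ℕ→ℚ-suc k)) (sym (ℚ.+-assoc a (ℕ→ℚ k) 1ℚ))

ℕ→ℚ-inverseʳ : ∀ d .{{_ : ℕ.NonZero d}} → ℕ→ℚ d * (ℤ.+ 1 / d) ≡ 1ℚ
ℕ→ℚ-inverseʳ (suc m) = begin
  ℕ→ℚ (suc m) * (ℤ.+ 1 / suc m) ≡⟨ cong₂ _*_ (ℕ→ℚ≡mkℚ (suc m)) (ℚ.↥p/↧p≡p (mkℚ (ℤ.+ 1) m (1-coprimeTo (suc m)))) ⟩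
  p * 1/ p                       ≡⟨ ℚ.*-inverseʳ p ⟩
  1ℚ                             ∎
  where p = mkℚ (ℤ.+ suc m) 0 (coprime-sym (1-coprimeTo (suc m)))

ℕ→ℚ-cancelˡ : ∀ d .{{_ : ℕ.NonZero d}} {a b} → ℕ→ℚ d * a ≡ ℕ→ℚ d * b → a ≡ b
ℕ→ℚ-cancelˡ d {a} {b} eq = trans (unscale a) (trans (cong ((ℤ.+ 1 / d) *_) eq) (sym (unscale b)))
  where
  unscale : ∀ c → c ≡ (ℤ.+ 1 / d) * (ℕ→ℚ d * c)
  unscale c = begin
    c                         ≡⟨ sym (ℚ.*-identityˡ c) ⟩
    1ℚ * c                    ≡⟨ cong (_* c) (sym (ℕ→ℚ-inverseʳ d)) ⟩
    ℕ→ℚ d * (ℤ.+ 1 / d) * c   ≡⟨ solve 3 (λ D E c → D :* E :* c := E :* (D :* c)) refl (ℕ→ℚ d) (ℤ.+ 1 / d) c ⟩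
    (ℤ.+ 1 / d) * (ℕ→ℚ d * c) ∎

_!⁻¹ : ℕ → ℚ
k !⁻¹ = (ℤ.+ 1 / k !) {{k !≢0}}

!*!⁻¹≡1 : ∀ k → ℕ→ℚ (k !) * k !⁻¹ ≡ 1ℚ
!*!⁻¹≡1 k = ℕ→ℚ-inverseʳ (k !) {{k !≢0}}

!⁻¹-suc : ∀ k → k !⁻¹ ≡ ℕ→ℚ (suc k) * suc k !⁻¹
!⁻¹-suc k = begin
  k !⁻¹                                      ≡⟨ sym (ℚ.*-identityʳ (k !⁻¹)) ⟩
  k !⁻¹ * 1ℚ                                 ≡⟨ cong (k !⁻¹ *_) (sym (!*!⁻¹≡1 (suc k))) ⟩
  k !⁻¹ * (ℕ→ℚ (suc k ℕ.* k !) * suc k !⁻¹) ≡⟨ cong (λ z → k !⁻¹ * (z * suc k !⁻¹)) (ℕ→ℚ-* (suc k) (k !)) ⟩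
  k !⁻¹ * (s * f * suc k !⁻¹)               ≡⟨ solve 4 (λ i s f j → i :* (s :* f :* j) := (f :* i) :* (s :* j)) refl (k !⁻¹) s f (suc k !⁻¹) ⟩
  f * k !⁻¹ * (s * suc k !⁻¹)               ≡⟨ cong (_* (s * suc k !⁻¹)) (!*!⁻¹≡1 k) ⟩
  1ℚ * (s * suc k !⁻¹)                       ≡⟨ ℚ.*-identityˡ _ ⟩
  s * suc k !⁻¹                              ∎
  where s = ℕ→ℚ (suc k)
        f = ℕ→ℚ (k !)

fall-+1 : ∀ a m → fall (a + 1ℚ) (suc m) ≡ (a + 1ℚ) * fall a m
fall-+1 a zero = solve 1 (λ b → con 1ℚ :* (b :- con 0ℚ) := b :* con 1ℚ) refl (a + 1ℚ)
fall-+1 a (suc m) = begin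
  fall (a + 1ℚ) (suc m) * (a + 1ℚ - ℕ→ℚ (suc m))  ≡⟨ cong₂ (λ u v → u * (a + 1ℚ - v)) (fall-+1 a m) (ℕ→ℚ-suc m) ⟩
  (a + 1ℚ) * fall a m * (a + 1ℚ - (M + 1ℚ))       ≡⟨ solve 3 (λ a f M → (a :+ con 1ℚ) :* f :* (a :+ con 1ℚ :- (M :+ con 1ℚ))
                                                                  := (a :+ con 1ℚ) :* (f :* (a :- M))) refl a (fall a m) M ⟩
  (a + 1ℚ) * (fall a m * (a - M))                 ∎
  where M = ℕ→ℚ m

fall-+ : ∀ a p q → fall a (p ℕ.+ q) ≡ fall a p * fall (a - ℕ→ℚ p) q
fall-+ a p zero rewrite ℕₚ.+-identityʳ p = sym (ℚ.*-identityʳ _)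
fall-+ a p (suc q) rewrite ℕₚ.+-suc p q = begin
  fall a (p ℕ.+ q) * (a - ℕ→ℚ (p ℕ.+ q))    ≡⟨ cong₂ (λ u v → u * (a - v)) (fall-+ a p q) (ℕ→ℚ-+ p q) ⟩
  F * G * (a - (P + Q))                     ≡⟨ solve 5 (λ a F G P Q → F :* G :* (a :- (P :+ Q)) := F :* (G :* (a :- P :- Q)))
                                                   refl a F G P Q ⟩
  F * (G * (a - P - Q))                     ∎
  where F = fall a p
        G = fall (a - ℕ→ℚ p) q
        P = ℕ→ℚ p
        Q = ℕ→ℚ q

fall-ℕ→ℚ-self : ∀ m → fall (ℕ→ℚ m) m ≡ ℕ→ℚ (m !)
fall-ℕ→ℚ-self zero = refl
fall-ℕ→ℚ-self (suc m) = begin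
  fall (ℕ→ℚ (suc m)) (suc m)      ≡⟨ cong (λ z → fall z (suc m)) (ℕ→ℚ-suc m) ⟩
  fall (ℕ→ℚ m + 1ℚ) (suc m)       ≡⟨ fall-+1 (ℕ→ℚ m) m ⟩
  (ℕ→ℚ m + 1ℚ) * fall (ℕ→ℚ m) m   ≡⟨ cong₂ _*_ (sym (ℕ→ℚ-suc m)) (fall-ℕ→ℚ-self m) ⟩
  ℕ→ℚ (suc m) * ℕ→ℚ (m !)         ≡⟨ sym (ℕ→ℚ-* (suc m) (m !)) ⟩
  ℕ→ℚ (suc m !)                   ∎

fall-ℕ→ℚ-< : ∀ {m k} → m < k → fall (ℕ→ℚ m) k ≡ 0ℚ
fall-ℕ→ℚ-< {m} {suc k} m<1+k with ℕₚ.m<1+n⇒m<n∨m≡n m<1+k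
... | inj₁ m<k  = trans (cong (_* (ℕ→ℚ m - ℕ→ℚ k)) (fall-ℕ→ℚ-< m<k)) (ℚ.*-zeroˡ (ℕ→ℚ m - ℕ→ℚ k))
... | inj₂ refl = trans (cong (fall (ℕ→ℚ m) m *_) (ℚ.+-inverseʳ (ℕ→ℚ m))) (ℚ.*-zeroʳ (fall (ℕ→ℚ m) m))

fall-ℕ→ℚ*! : ∀ {k n} → k ≤ n → fall (ℕ→ℚ n) k * ℕ→ℚ ((n ∸ k) !) ≡ ℕ→ℚ (n !)
fall-ℕ→ℚ*! {k} {n} k≤n = begin
  fall N k * ℕ→ℚ (d !)           ≡⟨ cong (fall N k *_) (sym (fall-ℕ→ℚ-self d)) ⟩
  fall N k * fall (ℕ→ℚ d) d      ≡⟨ cong (λ z → fall N k * fall z d) (ℕ→ℚ-∸ k≤n) ⟩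
  fall N k * fall (N - ℕ→ℚ k) d  ≡⟨ sym (fall-+ N k d) ⟩
  fall N (k ℕ.+ d)               ≡⟨ cong (fall N) (ℕₚ.m+[n∸m]≡n k≤n) ⟩
  fall N n                       ≡⟨ fall-ℕ→ℚ-self n ⟩
  ℕ→ℚ (n !)                      ∎
  where N = ℕ→ℚ n
        d = n ∸ k

fall-ℕ→ℚ*!⁻¹ : ∀ {k n} → k ≤ n → fall (ℕ→ℚ n) k * n !⁻¹ ≡ (n ∸ k) !⁻¹
fall-ℕ→ℚ*!⁻¹ {k} {n} k≤n = begin
  F * n !⁻¹                            ≡⟨ sym (ℚ.*-identityʳ _) ⟩
  F * n !⁻¹ * 1ℚ                       ≡⟨ cong (F * n !⁻¹ *_) (sym (!*!⁻¹≡1 d)) ⟩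
  F * n !⁻¹ * (ℕ→ℚ (d !) * d !⁻¹)      ≡⟨ solve 4 (λ F i f j → F :* i :* (f :* j) := F :* f :* i :* j) refl F (n !⁻¹) (ℕ→ℚ (d !)) (d !⁻¹) ⟩
  F * ℕ→ℚ (d !) * n !⁻¹ * d !⁻¹        ≡⟨ cong (λ z → z * n !⁻¹ * d !⁻¹) (fall-ℕ→ℚ*! k≤n) ⟩
  ℕ→ℚ (n !) * n !⁻¹ * d !⁻¹            ≡⟨ cong (_* d !⁻¹) (!*!⁻¹≡1 n) ⟩
  1ℚ * d !⁻¹                           ≡⟨ ℚ.*-identityˡ _ ⟩
  d !⁻¹                                ∎
  where F = fall (ℕ→ℚ n) k
        d = n ∸ k

fall-neg-sq : ∀ a k → fall (- a + - 1ℚ) k * fall (- a + - 1ℚ) k ≡ fall (a + ℕ→ℚ k) k * fall (a + ℕ→ℚ k) k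
fall-neg-sq a zero = refl
fall-neg-sq a (suc k) = begin
  F * (- a + - 1ℚ - K) * (F * (- a + - 1ℚ - K))  ≡⟨ solve 3 (λ F a K → F :* (:- a :+ :- con 1ℚ :- K) :* (F :* (:- a :+ :- con 1ℚ :- K))
                                                                  := F :* F :* ((a :+ K :+ con 1ℚ) :* (a :+ K :+ con 1ℚ))) refl F a K ⟩
  F * F * (b * b)                                ≡⟨ cong (_* (b * b)) (fall-neg-sq a k) ⟩
  G * G * (b * b)                                ≡⟨ solve 2 (λ G b → G :* G :* (b :* b) := b :* G :* (b :* G)) refl G b ⟩
  b * G * (b * G)                                ≡⟨ cong (λ z → z * z) (sym shift) ⟩
  fall (a + ℕ→ℚ (suc k)) (suc k) * fall (a + ℕ→ℚ (suc k)) (suc k) ∎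
  where F = fall (- a + - 1ℚ) k
        K = ℕ→ℚ k
        G = fall (a + K) k
        b = a + K + 1ℚ
        shift : fall (a + ℕ→ℚ (suc k)) (suc k) ≡ b * G
        shift = trans (cong (λ z → fall z (suc k)) (+-ℕ→ℚ-suc a k)) (fall-+1 (a + K) k)

choose-pascal : ∀ a j → choose (a + 1ℚ) (suc j) ≡ choose a j + choose a (suc j)
choose-pascal a j = begin
  fall (a + 1ℚ) (suc j) * suc j !⁻¹                      ≡⟨ cong (_* suc j !⁻¹) (fall-+1 a j) ⟩
  (a + 1ℚ) * F * suc j !⁻¹                               ≡⟨ solve 4 (λ a F J I → (a :+ con 1ℚ) :* F :* I
                                                                     := F :* ((J :+ con 1ℚ) :* I) :+ F :* (a :- J) :* I)
                                                               refl a F J (suc j !⁻¹) ⟩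
  F * ((J + 1ℚ) * suc j !⁻¹) + F * (a - J) * suc j !⁻¹   ≡⟨ cong (λ z → F * z + F * (a - J) * suc j !⁻¹) (sym j!⁻¹≡) ⟩
  F * j !⁻¹ + F * (a - J) * suc j !⁻¹                    ∎
  where F = fall a j
        J = ℕ→ℚ j
        j!⁻¹≡ : j !⁻¹ ≡ (J + 1ℚ) * suc j !⁻¹
        j!⁻¹≡ = trans (!⁻¹-suc j) (cong (_* suc j !⁻¹) (ℕ→ℚ-suc j))

choose-ℕ→ℚ : ∀ m k → ℕ→ℚ (m C k) ≡ choose (ℕ→ℚ m) k
choose-ℕ→ℚ m zero = refl
choose-ℕ→ℚ zero (suc k) = sym (trans (cong (_* suc k !⁻¹) (fall-ℕ→ℚ-< {0} {suc k} (s≤s ℕ.z≤n))) (ℚ.*-zeroˡ (suc k !⁻¹)))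
choose-ℕ→ℚ (suc m) (suc k) = begin
  ℕ→ℚ (suc m C suc k)                       ≡⟨ cong ℕ→ℚ (sym (nCk+nC[k+1]≡[n+1]C[k+1] m k)) ⟩
  ℕ→ℚ (m C k ℕ.+ m C suc k)                 ≡⟨ ℕ→ℚ-+ (m C k) (m C suc k) ⟩
  ℕ→ℚ (m C k) + ℕ→ℚ (m C suc k)             ≡⟨ cong₂ _+_ (choose-ℕ→ℚ m k) (choose-ℕ→ℚ m (suc k)) ⟩
  choose M k + choose M (suc k)             ≡⟨ sym (choose-pascal M k) ⟩
  choose (M + 1ℚ) (suc k)                   ≡⟨ cong (λ z → choose z (suc k)) (sym (ℕ→ℚ-suc m)) ⟩
  choose (ℕ→ℚ (suc m)) (suc k)              ∎
  where M = ℕ→ℚ m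

choose-upper-absorb : ∀ a k → (a + 1ℚ) * choose a k ≡ (a + 1ℚ - ℕ→ℚ k) * choose (a + 1ℚ) k
choose-upper-absorb a zero = solve 2 (λ a c → (a :+ con 1ℚ) :* c := (a :+ con 1ℚ :- con 0ℚ) :* c) refl a (choose a zero)
choose-upper-absorb a (suc j) = begin
  (a + 1ℚ) * (F * (a - J) * suc j !⁻¹)             ≡⟨ solve 4 (λ a F J I → (a :+ con 1ℚ) :* (F :* (a :- J) :* I)
                                                                  := (a :+ con 1ℚ :- (J :+ con 1ℚ)) :* ((a :+ con 1ℚ) :* F :* I))
                                                          refl a F J (suc j !⁻¹) ⟩
  (a + 1ℚ - (J + 1ℚ)) * ((a + 1ℚ) * F * suc j !⁻¹) ≡⟨ cong₂ (λ u v → (a + 1ℚ - u) * (v * suc j !⁻¹)) (sym (ℕ→ℚ-suc j)) (sym (fall-+1 a j)) ⟩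
  (a + 1ℚ - ℕ→ℚ (suc j)) * choose (a + 1ℚ) (suc j) ∎
  where F = fall a j
        J = ℕ→ℚ j

choose-absorb : ∀ a j → ℕ→ℚ (suc j) * choose (a + 1ℚ) (suc j) ≡ (a + 1ℚ) * choose a j
choose-absorb a j = begin
  S * (fall (a + 1ℚ) (suc j) * suc j !⁻¹)  ≡⟨ cong (λ z → S * (z * suc j !⁻¹)) (fall-+1 a j) ⟩
  S * ((a + 1ℚ) * F * suc j !⁻¹)          ≡⟨ solve 4 (λ a F S I → S :* ((a :+ con 1ℚ) :* F :* I) := (a :+ con 1ℚ) :* (F :* (S :* I)))
                                                  refl a F S (suc j !⁻¹) ⟩
  (a + 1ℚ) * (F * (S * suc j !⁻¹))        ≡⟨ cong (λ z → (a + 1ℚ) * (F * z)) (sym (!⁻¹-suc j)) ⟩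
  (a + 1ℚ) * choose a j                   ∎
  where F = fall a j
        S = ℕ→ℚ (suc j)

-- coeff m k = 1 / (k! (m - k)!) for k ≤ m, and 0 for k > m.
coeff : ℕ → ℕ → ℚ
coeff m k = ℕ→ℚ (m C k) * m !⁻¹

coeff-> : ∀ {m k} → m < k → coeff m k ≡ 0ℚ
coeff-> {m} m<k = trans (cong (λ c → ℕ→ℚ c * m !⁻¹) (k>n⇒nCk≡0 m<k)) (ℚ.*-zeroˡ (m !⁻¹))

coeff-≤ : ∀ {k n} → k ≤ n → coeff n k ≡ k !⁻¹ * (n ∸ k) !⁻¹
coeff-≤ {k} {n} k≤n = begin
  ℕ→ℚ (n C k) * n !⁻¹              ≡⟨ cong (_* n !⁻¹) (choose-ℕ→ℚ n k) ⟩
  fall (ℕ→ℚ n) k * k !⁻¹ * n !⁻¹   ≡⟨ solve 3 (λ F i j → F :* i :* j := i :* (F :* j)) refl (fall (ℕ→ℚ n) k) (k !⁻¹) (n !⁻¹) ⟩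
  k !⁻¹ * (fall (ℕ→ℚ n) k * n !⁻¹) ≡⟨ cong (k !⁻¹ *_) (fall-ℕ→ℚ*!⁻¹ k≤n) ⟩
  k !⁻¹ * (n ∸ k) !⁻¹              ∎

coeff-expand : ∀ m k → coeff m k ≡ (ℕ→ℚ m + 1ℚ) * choose (ℕ→ℚ m) k * suc m !⁻¹
coeff-expand m k = begin
  ℕ→ℚ (m C k) * m !⁻¹                     ≡⟨ cong₂ _*_ (choose-ℕ→ℚ m k) (!⁻¹-suc m) ⟩
  choose M k * (ℕ→ℚ (suc m) * suc m !⁻¹)  ≡⟨ cong (λ z → choose M k * (z * suc m !⁻¹)) (ℕ→ℚ-suc m) ⟩
  choose M k * ((M + 1ℚ) * suc m !⁻¹)     ≡⟨ solve 3 (λ c a i → c :* (a :* i) := a :* c :* i) refl (choose M k) (M + 1ℚ) (suc m !⁻¹) ⟩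
  (M + 1ℚ) * choose M k * suc m !⁻¹       ∎
  where M = ℕ→ℚ m

coeff-suc-expand : ∀ m k → coeff (suc m) k ≡ choose (ℕ→ℚ m + 1ℚ) k * suc m !⁻¹
coeff-suc-expand m k = cong (_* suc m !⁻¹) (trans (choose-ℕ→ℚ (suc m) k) (cong (λ z → choose z k) (ℕ→ℚ-suc m)))

coeff≡[m+1-k]*coeff[m+1] : ∀ m k → coeff m k ≡ (ℕ→ℚ m + 1ℚ - ℕ→ℚ k) * coeff (suc m) k
coeff≡[m+1-k]*coeff[m+1] m k = begin
  coeff m k                                           ≡⟨ coeff-expand m k ⟩
  (M + 1ℚ) * choose M k * suc m !⁻¹                   ≡⟨ cong (_* suc m !⁻¹) (choose-upper-absorb M k) ⟩
  (M + 1ℚ - ℕ→ℚ k) * choose (M + 1ℚ) k * suc m !⁻¹    ≡⟨ ℚ.*-assoc (M + 1ℚ - ℕ→ℚ k) _ _ ⟩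
  (M + 1ℚ - ℕ→ℚ k) * (choose (M + 1ℚ) k * suc m !⁻¹)  ≡⟨ cong ((M + 1ℚ - ℕ→ℚ k) *_) (coeff-suc-expand m k) ⟨
  (M + 1ℚ - ℕ→ℚ k) * coeff (suc m) k                  ∎
  where M = ℕ→ℚ m

coeff≡[k+1]*coeff[m+1,k+1] : ∀ m k → coeff m k ≡ ℕ→ℚ (suc k) * coeff (suc m) (suc k)
coeff≡[k+1]*coeff[m+1,k+1] m k = begin
  coeff m k                                             ≡⟨ coeff-expand m k ⟩
  (M + 1ℚ) * choose M k * suc m !⁻¹                     ≡⟨ cong (_* suc m !⁻¹) (sym (choose-absorb M k)) ⟩
  ℕ→ℚ (suc k) * choose (M + 1ℚ) (suc k) * suc m !⁻¹     ≡⟨ ℚ.*-assoc (ℕ→ℚ (suc k)) _ _ ⟩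
  ℕ→ℚ (suc k) * (choose (M + 1ℚ) (suc k) * suc m !⁻¹)   ≡⟨ cong (ℕ→ℚ (suc k) *_) (coeff-suc-expand m (suc k)) ⟨
  ℕ→ℚ (suc k) * coeff (suc m) (suc k)                   ∎
  where M = ℕ→ℚ m

Σ-cong : ∀ n {f g : ℕ → ℚ} → (∀ k → k ≤ n → f k ≡ g k) → Σ[0to n ] f ≡ Σ[0to n ] g
Σ-cong zero    f≗g = f≗g zero ℕ.z≤n
Σ-cong (suc n) f≗g = cong₂ _+_ (Σ-cong n (λ k k≤n → f≗g k (ℕₚ.m≤n⇒m≤1+n k≤n))) (f≗g (suc n) ℕₚ.≤-refl)

Σ-telescope : ∀ n (G : ℕ → ℚ) → Σ[0to n ] (λ k → G (suc k) - G k) ≡ G (suc n) - G 0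
Σ-telescope zero G = refl
Σ-telescope (suc n) G = begin
  Σ[0to n ] (λ k → G (suc k) - G k) + (G (2+n) - G (suc n)) ≡⟨ cong (_+ (G (2+n) - G (suc n))) (Σ-telescope n G) ⟩
  G (suc n) - G 0 + (G (2+n) - G (suc n))                   ≡⟨ solve 3 (λ a b c → b :- a :+ (c :- b) := c :- a) refl (G 0) (G (suc n)) (G (2+n)) ⟩
  G (2+n) - G 0                                              ∎
  where 2+n = suc (suc n)

Σ-extend : ∀ {m p} {f : ℕ → ℚ} → (∀ k → m < k → f k ≡ 0ℚ) → m ≤′ p → Σ[0to p ] f ≡ Σ[0to m ] f
Σ-extend vanish ≤′-refl = refl
Σ-extend {m} {suc p} {f} vanish (≤′-step m≤′p) = begin
  Σ[0to p ] f + f (suc p) ≡⟨ cong (Σ[0to p ] f +_) (vanish (suc p) (s≤s (ℕₚ.≤′⇒≤ m≤′p))) ⟩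
  Σ[0to p ] f + 0ℚ        ≡⟨ ℚ.+-identityʳ _ ⟩
  Σ[0to p ] f             ≡⟨ Σ-extend vanish m≤′p ⟩
  Σ[0to m ] f             ∎

p₀ p₂ : ℚ → ℚ
p₀ N = (N + 1ℚ) * (N + 1ℚ) * (N + 1ℚ)
p₂ N = (N + ℕ→ℚ 2) * (N + ℕ→ℚ 2) * (N + ℕ→ℚ 2)

p₁ : ℚ → ℚ → ℚ
p₁ N x = (ℕ→ℚ 2 * N + ℕ→ℚ 3) * (N * N + ℕ→ℚ 3 * N + ℕ→ℚ 3 + ℕ→ℚ 2 * x * (x + 1ℚ))

recurrence : (x N a₀ a₁ a₂ : ℚ) → ℚ
recurrence x N a₀ a₁ a₂ = p₂ N * a₂ - p₁ N x * a₁ + p₀ N * a₀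

recurrenceAt : ℚ → (ℕ → ℚ) → ℕ → ℚ
recurrenceAt x s n = recurrence x (ℕ→ℚ n) (s n) (s (suc n)) (s (suc (suc n)))

recurrence-cong : ∀ x N {a₀ a₁ a₂ b₀ b₁ b₂} → a₀ ≡ b₀ → a₁ ≡ b₁ → a₂ ≡ b₂ → recurrence x N a₀ a₁ a₂ ≡ recurrence x N b₀ b₁ b₂
recurrence-cong x N refl refl refl = refl

Σ-recurrence : ∀ x N p (f₀ f₁ f₂ : ℕ → ℚ) →
  Σ[0to p ] (λ k → recurrence x N (f₀ k) (f₁ k) (f₂ k)) ≡ recurrence x N (Σ[0to p ] f₀) (Σ[0to p ] f₁) (Σ[0to p ] f₂)
Σ-recurrence x N zero    f₀ f₁ f₂ = refl
Σ-recurrence x N (suc p) f₀ f₁ f₂ = begin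
  Σ[0to p ] r + r (suc p)                                   ≡⟨ cong (_+ r (suc p)) (Σ-recurrence x N p f₀ f₁ f₂) ⟩
  recurrence x N (Σ[0to p ] f₀) (Σ[0to p ] f₁) (Σ[0to p ] f₂) + r (suc p)
    ≡⟨ solve 9 (λ a b c F₀ F₁ F₂ g₀ g₁ g₂ → a :* F₂ :- b :* F₁ :+ c :* F₀ :+ (a :* g₂ :- b :* g₁ :+ c :* g₀)
                                             := a :* (F₂ :+ g₂) :- b :* (F₁ :+ g₁) :+ c :* (F₀ :+ g₀))
         refl (p₂ N) (p₁ N x) (p₀ N) (Σ[0to p ] f₀) (Σ[0to p ] f₁) (Σ[0to p ] f₂) (f₀ (suc p)) (f₁ (suc p)) (f₂ (suc p)) ⟩
  recurrence x N (Σ[0to suc p ] f₀) (Σ[0to suc p ] f₁) (Σ[0to suc p ] f₂) ∎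
  where r : ℕ → ℚ
        r k = recurrence x N (f₀ k) (f₁ k) (f₂ k)

creative-telescoping : ∀ x n (T : ℕ → ℕ → ℚ) (G : ℕ → ℚ) →
  (∀ m k → m < k → T m k ≡ 0ℚ) →
  (∀ k → recurrence x (ℕ→ℚ n) (T n k) (T (suc n) k) (T (suc (suc n)) k) ≡ G (suc k) - G k) →
  G 0 ≡ 0ℚ → G (suc (suc (suc n))) ≡ 0ℚ →
  recurrenceAt x (λ m → Σ[0to m ] (T m)) n ≡ 0ℚ
creative-telescoping x n T G support telescopes G₀≡0 G₃≡0 = begin
  recurrence x N (Σ[0to n ] (T n)) (Σ[0to suc n ] (T (suc n))) (Σ[0to n₂ ] (T n₂))
    ≡⟨ recurrence-cong x N (Σ-extend (support n) (≤′-step (≤′-step ≤′-refl))) (Σ-extend (support (suc n)) (≤′-step ≤′-refl)) refl ⟨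
  recurrence x N (Σ[0to n₂ ] (T n)) (Σ[0to n₂ ] (T (suc n))) (Σ[0to n₂ ] (T n₂))
    ≡⟨ Σ-recurrence x N n₂ (T n) (T (suc n)) (T n₂) ⟨
  Σ[0to n₂ ] (λ k → recurrence x N (T n k) (T (suc n) k) (T n₂ k))
    ≡⟨ Σ-cong n₂ (λ k _ → telescopes k) ⟩
  Σ[0to n₂ ] (λ k → G (suc k) - G k)
    ≡⟨ Σ-telescope n₂ G ⟩
  G (suc n₂) - G 0
    ≡⟨ cong₂ _-_ G₃≡0 G₀≡0 ⟩
  0ℚ ∎
  where N  = ℕ→ℚ n
        n₂ = suc (suc n)

recurrence-leading : ∀ x N a₀ a₁ a₂ → recurrence x N a₀ a₁ a₂ ≡ 0ℚ → p₂ N * a₂ ≡ p₁ N x * a₁ - p₀ N * a₀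
recurrence-leading x N a₀ a₁ a₂ eq = begin
  p₂ N * a₂                                            ≡⟨ solve 6 (λ a b c a₀ a₁ a₂ → a :* a₂ := (a :* a₂ :- b :* a₁ :+ c :* a₀) :+ (b :* a₁ :- c :* a₀))
                                                               refl (p₂ N) (p₁ N x) (p₀ N) a₀ a₁ a₂ ⟩
  recurrence x N a₀ a₁ a₂ + (p₁ N x * a₁ - p₀ N * a₀)  ≡⟨ cong (_+ (p₁ N x * a₁ - p₀ N * a₀)) eq ⟩
  0ℚ + (p₁ N x * a₁ - p₀ N * a₀)                       ≡⟨ ℚ.+-identityˡ _ ⟩
  p₁ N x * a₁ - p₀ N * a₀                              ∎

p₂-ℕ→ℚ : ∀ n → p₂ (ℕ→ℚ n) ≡ ℕ→ℚ (suc (suc n) ℕ.* suc (suc n) ℕ.* suc (suc n))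
p₂-ℕ→ℚ n = begin
  (N + ℕ→ℚ 2) * (N + ℕ→ℚ 2) * (N + ℕ→ℚ 2)  ≡⟨ cong (λ z → z * z * z) (trans (cong ℕ→ℚ (ℕₚ.+-comm 2 n)) (ℕ→ℚ-+ n 2)) ⟨
  S * S * S                                ≡⟨ trans (ℕ→ℚ-* (s ℕ.* s) s) (cong (_* S) (ℕ→ℚ-* s s)) ⟨
  ℕ→ℚ (s ℕ.* s ℕ.* s)                      ∎
  where N = ℕ→ℚ n
        s = suc (suc n)
        S = ℕ→ℚ s

recurrence-unique : ∀ x {s t : ℕ → ℚ} →
  (∀ n → recurrenceAt x s n ≡ 0ℚ) → (∀ n → recurrenceAt x t n ≡ 0ℚ) →
  s 0 ≡ t 0 → s 1 ≡ t 1 → ∀ n → s n ≡ t n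
recurrence-unique x {s} {t} s-rec t-rec s₀≡t₀ s₁≡t₁ n = proj₁ (agree n)
  where
  next : ∀ n → s n ≡ t n → s (suc n) ≡ t (suc n) → s (suc (suc n)) ≡ t (suc (suc n))
  next n sₙ≡tₙ sₙ₊₁≡tₙ₊₁ = ℕ→ℚ-cancelˡ (c ℕ.* c ℕ.* c) (begin
    ℕ→ℚ (c ℕ.* c ℕ.* c) * s c       ≡⟨ cong (_* s c) (p₂-ℕ→ℚ n) ⟨
    p₂ N * s c                     ≡⟨ recurrence-leading x N _ _ _ (s-rec n) ⟩
    p₁ N x * s (suc n) - p₀ N * s n ≡⟨ cong₂ (λ u v → p₁ N x * v - p₀ N * u) sₙ≡tₙ sₙ₊₁≡tₙ₊₁ ⟩
    p₁ N x * t (suc n) - p₀ N * t n ≡⟨ recurrence-leading x N _ _ _ (t-rec n) ⟨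
    p₂ N * t c                     ≡⟨ cong (_* t c) (p₂-ℕ→ℚ n) ⟩
    ℕ→ℚ (c ℕ.* c ℕ.* c) * t c       ∎)
    where N = ℕ→ℚ n
          c = suc (suc n)
  agree : ∀ n → s n ≡ t n × s (suc n) ≡ t (suc n)
  agree zero    = s₀≡t₀ , s₁≡t₁
  agree (suc n) = let (sₙ≡tₙ , sₙ₊₁≡tₙ₊₁) = agree n in sₙ₊₁≡tₙ₊₁ , next n sₙ≡tₙ sₙ₊₁≡tₙ₊₁

_² : ℚ → ℚ
a ² = a * a

-- lhsPoly and rhsFactor are read off from the certificates found by Zeilberger's algorithm.
lhsPoly : (N K x : ℚ) → ℚ
lhsPoly N K x = (ℕ→ℚ 3 * N * N + ℕ→ℚ 9 * N + ℕ→ℚ 6 - ℕ→ℚ 4 * N * K - ℕ→ℚ 6 * K + K * K)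
              + (ℕ→ℚ 4 * N * N + ℕ→ℚ 10 * N + ℕ→ℚ 4 - ℕ→ℚ 6 * N * K - ℕ→ℚ 8 * K + ℕ→ℚ 2 * K * K) * x
              + (ℕ→ℚ 2 * K - ℕ→ℚ 3 * N - ℕ→ℚ 6) * x * x

rhsFactor : ℚ → ℚ
rhsFactor N = 0ℚ - ℕ→ℚ 2 * (ℕ→ℚ 2 * N + ℕ→ℚ 3)

-- The variables stand for N = n, K = k, β = coeff (n+2) k and φ = (x+k)_n.
lhs-certificate-identity : ∀ N K x β φ t₀ t₁ t₂ g₀ g₁ →
  t₀ ≡ ((N + 1ℚ - K) * ((N + 1ℚ + 1ℚ - K) * β) * φ) ² →
  t₁ ≡ ((N + 1ℚ + 1ℚ - K) * β * (φ * (x + K - N))) ² →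
  t₂ ≡ (β * (φ * (x + K - N) * (x + K - (N + 1ℚ)))) ² →
  g₀ ≡ (K * β * (φ * (x + K - N))) ² * lhsPoly N K x →
  g₁ ≡ ((N + 1ℚ + 1ℚ - K) * β * ((x + K + 1ℚ) * φ)) ² * lhsPoly N (K + 1ℚ) x →
  recurrence x N t₀ t₁ t₂ ≡ g₁ - g₀
lhs-certificate-identity N K x β φ _ _ _ _ _ refl refl refl refl refl = solve 5 (λ N K x β φ →
   let c : ℕ → _
       c m = con (ℕ→ℚ m)
       o = con 1ℚ
       sq = λ a → a :* a
       q = λ K → (c 3 :* N :* N :+ c 9 :* N :+ c 6 :- c 4 :* N :* K :- c 6 :* K :+ K :* K)
               :+ (c 4 :* N :* N :+ c 10 :* N :+ c 4 :- c 6 :* N :* K :- c 8 :* K :+ c 2 :* K :* K) :* x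
               :+ (c 2 :* K :- c 3 :* N :- c 6) :* x :* x
       q₂ = (N :+ c 2) :* (N :+ c 2) :* (N :+ c 2)
       q₀ = (N :+ o) :* (N :+ o) :* (N :+ o)
       q₁ = (c 2 :* N :+ c 3) :* (N :* N :+ c 3 :* N :+ c 3 :+ c 2 :* x :* (x :+ o))
   in q₂ :* sq (β :* (φ :* (x :+ K :- N) :* (x :+ K :- (N :+ o))))
      :- q₁ :* sq ((N :+ o :+ o :- K) :* β :* (φ :* (x :+ K :- N)))
      :+ q₀ :* sq ((N :+ o :- K) :* ((N :+ o :+ o :- K) :* β) :* φ)
    := sq ((N :+ o :+ o :- K) :* β :* ((x :+ K :+ o) :* φ)) :* q (K :+ o)
       :- sq (K :* β :* (φ :* (x :+ K :- N))) :* q K) refl N K x β φ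

module LeftSide (x : ℚ) where

  term : ℕ → ℕ → ℚ
  term m k = (coeff m k * fall (x + ℕ→ℚ k) m) ²

  term-> : ∀ m k → m < k → term m k ≡ 0ℚ
  term-> m k m<k = begin
    (coeff m k * F) ²  ≡⟨ cong (λ c → (c * F) ²) (coeff-> m<k) ⟩
    (0ℚ * F) ²         ≡⟨ solve 1 (λ F → (con 0ℚ :* F) :* (con 0ℚ :* F) := con 0ℚ) refl F ⟩
    0ℚ                 ∎
    where F = fall (x + ℕ→ℚ k) m

  summand≡term : ∀ n k → k ≤ n →
    (choose (- x + - 1ℚ) k * choose (- x + - 1ℚ) k) * (choose x (n ∸ k) * choose x (n ∸ k)) ≡ term n k
  summand≡term n k k≤n = begin
    (F * k !⁻¹ * (F * k !⁻¹)) * (H * d !⁻¹ * (H * d !⁻¹))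
      ≡⟨ solve 4 (λ F i H j → (F :* i :* (F :* i)) :* (H :* j :* (H :* j)) := F :* F :* ((i :* j :* H) :* (i :* j :* H)))
               refl F (k !⁻¹) H (d !⁻¹) ⟩
    F * F * (k !⁻¹ * d !⁻¹ * H) ²      ≡⟨ cong (_* (k !⁻¹ * d !⁻¹ * H) ²) (fall-neg-sq x k) ⟩
    G * G * (k !⁻¹ * d !⁻¹ * H) ²      ≡⟨ solve 4 (λ G i j H → G :* G :* ((i :* j :* H) :* (i :* j :* H)) := (i :* j :* (G :* H)) :* (i :* j :* (G :* H)))
                                               refl G (k !⁻¹) (d !⁻¹) H ⟩
    (k !⁻¹ * d !⁻¹ * (G * H)) ²        ≡⟨ cong₂ (λ c F → (c * F) ²) (coeff-≤ k≤n) split ⟨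
    (coeff n k * fall (x + K) n) ²     ∎
    where
    K = ℕ→ℚ k
    d = n ∸ k
    F = fall (- x + - 1ℚ) k
    G = fall (x + K) k
    H = fall x d
    split : fall (x + K) n ≡ G * H
    split = begin
      fall (x + K) n            ≡⟨ cong (fall (x + K)) (ℕₚ.m+[n∸m]≡n k≤n) ⟨
      fall (x + K) (k ℕ.+ d)    ≡⟨ fall-+ (x + K) k d ⟩
      G * fall (x + K - K) d    ≡⟨ cong (λ z → G * fall z d) (solve 2 (λ x K → x :+ K :- K := x) refl x K) ⟩
      G * H                     ∎

  certificate : ℕ → ℕ → ℚ
  certificate n zero    = 0ℚ
  certificate n (suc j) = (coeff (suc n) j * fall (x + ℕ→ℚ (suc j)) (suc n)) ² * lhsPoly (ℕ→ℚ n) (ℕ→ℚ (suc j)) x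

  certificate-uniform : ∀ n k → certificate n k
    ≡ (ℕ→ℚ k * coeff (suc (suc n)) k * (fall (x + ℕ→ℚ k) n * (x + ℕ→ℚ k - ℕ→ℚ n))) ² * lhsPoly (ℕ→ℚ n) (ℕ→ℚ k) x
  certificate-uniform n zero    = solve 3 (λ β φ q → con 0ℚ := (con 0ℚ :* β :* φ) :* (con 0ℚ :* β :* φ) :* q) refl
                                    (coeff (suc (suc n)) 0) (fall (x + 0ℚ) n * (x + 0ℚ - ℕ→ℚ n)) (lhsPoly (ℕ→ℚ n) 0ℚ x)
  certificate-uniform n (suc j) = cong (λ c → (c * (φ * (x + J - ℕ→ℚ n))) ² * lhsPoly (ℕ→ℚ n) J x) (coeff≡[k+1]*coeff[m+1,k+1] (suc n) j)
    where J = ℕ→ℚ (suc j)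
          φ = fall (x + J) n

  certificate-end : ∀ n → certificate n (suc (suc (suc n))) ≡ 0ℚ
  certificate-end n = begin
    (coeff (suc n) (suc (suc n)) * φ) ² * q ≡⟨ cong (λ c → (c * φ) ² * q) (coeff-> (ℕₚ.n<1+n (suc n))) ⟩
    (0ℚ * φ) ² * q                          ≡⟨ solve 2 (λ φ q → (con 0ℚ :* φ) :* (con 0ℚ :* φ) :* q := con 0ℚ) refl φ q ⟩
    0ℚ                                      ∎
    where φ = fall (x + ℕ→ℚ (suc (suc (suc n)))) (suc n)
          q = lhsPoly (ℕ→ℚ n) (ℕ→ℚ (suc (suc (suc n)))) x

  certificate-telescopes : ∀ n k →
    recurrence x (ℕ→ℚ n) (term n k) (term (suc n) k) (term (suc (suc n)) k) ≡ certificate n (suc k) - certificate n k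
  certificate-telescopes n k = lhs-certificate-identity N K x β φ _ _ _ _ _ t₀ t₁ t₂ (certificate-uniform n k) g₁
    where
    N = ℕ→ℚ n
    K = ℕ→ℚ k
    β = coeff (suc (suc n)) k
    φ = fall (x + K) n
    coeff₁ : coeff (suc n) k ≡ (N + 1ℚ + 1ℚ - K) * β
    coeff₁ = trans (coeff≡[m+1-k]*coeff[m+1] (suc n) k) (cong (λ z → (z + 1ℚ - K) * β) (ℕ→ℚ-suc n))
    t₀ : term n k ≡ ((N + 1ℚ - K) * ((N + 1ℚ + 1ℚ - K) * β) * φ) ²
    t₀ = cong (λ c → (c * φ) ²) (trans (coeff≡[m+1-k]*coeff[m+1] n k) (cong ((N + 1ℚ - K) *_) coeff₁))
    t₁ : term (suc n) k ≡ ((N + 1ℚ + 1ℚ - K) * β * (φ * (x + K - N))) ²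
    t₁ = cong (λ c → (c * (φ * (x + K - N))) ²) coeff₁
    t₂ : term (suc (suc n)) k ≡ (β * (φ * (x + K - N) * (x + K - (N + 1ℚ)))) ²
    t₂ = cong (λ z → (β * (φ * (x + K - N) * (x + K - z))) ²) (ℕ→ℚ-suc n)
    g₁ : certificate n (suc k) ≡ ((N + 1ℚ + 1ℚ - K) * β * ((x + K + 1ℚ) * φ)) ² * lhsPoly N (K + 1ℚ) x
    g₁ = trans (cong₂ (λ c F → (c * F) ² * lhsPoly N (ℕ→ℚ (suc k)) x) coeff₁
                      (trans (cong (λ z → fall z (suc n)) (+-ℕ→ℚ-suc x k)) (fall-+1 (x + K) n)))
               (cong (λ z → ((N + 1ℚ + 1ℚ - K) * β * ((x + K + 1ℚ) * φ)) ² * lhsPoly N z x) (ℕ→ℚ-suc k))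

  sum-recurrence : ∀ n → recurrenceAt x (λ m → Σ[0to m ] (term m)) n ≡ 0ℚ
  sum-recurrence n = creative-telescoping x n term (certificate n) term-> (certificate-telescopes n) refl (certificate-end n)

rhs-certificate-identity₀ : ∀ N x ι →
  recurrence x N (ι * 1ℚ * 1ℚ) (ι * 1ℚ * 1ℚ) (ι * 1ℚ * 1ℚ)
    ≡ rhsFactor N * ι * 1ℚ * ((1ℚ * (x + ℕ→ℚ 1 - ℕ→ℚ 0)) * (x + ℕ→ℚ 1 - ℕ→ℚ 1)) - 0ℚ
rhs-certificate-identity₀ = solve 3 (λ N x ι →
   let c : ℕ → _
       c m = con (ℕ→ℚ m)
       o = con 1ℚ
       r = con 0ℚ :- c 2 :* (c 2 :* N :+ c 3)
       q₂ = (N :+ c 2) :* (N :+ c 2) :* (N :+ c 2)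
       q₀ = (N :+ o) :* (N :+ o) :* (N :+ o)
       q₁ = (c 2 :* N :+ c 3) :* (N :* N :+ c 3 :* N :+ c 3 :+ c 2 :* x :* (x :+ o))
   in q₂ :* (ι :* o :* o) :- q₁ :* (ι :* o :* o) :+ q₀ :* (ι :* o :* o)
      := r :* ι :* o :* ((o :* (x :+ c 1 :- c 0)) :* (x :+ c 1 :- c 1)) :- con 0ℚ) refl

-- The variables stand for N = n, K = k = J + 1, ι = 1/k!, A = n + k, Q = (n+k)_(2k−2) and X = (x+k)_(2k).
rhs-certificate-identity : ∀ N J K x ι Q X A D₀ D₁ E t₀ t₁ t₂ g₀ g₁ →
  K ≡ J + 1ℚ → A ≡ N + K → D₀ ≡ J + J → D₁ ≡ D₀ + 1ℚ → E ≡ K + K →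
  t₀ ≡ (ι ²) ² * (Q * (A - D₀) * (A - D₁)) * X →
  t₁ ≡ (ι ²) ² * ((A + 1ℚ) * (Q * (A - D₀))) * X →
  t₂ ≡ (ι ²) ² * ((A + 1ℚ + 1ℚ) * ((A + 1ℚ) * Q)) * X →
  g₀ ≡ rhsFactor N * ((K * ι) ²) ² * Q * X →
  g₁ ≡ rhsFactor N * (ι ²) ² * ((A + 1ℚ) * (Q * (A - D₀))) * ((x + K + 1ℚ) * (X * (x + K - E))) →
  recurrence x N t₀ t₁ t₂ ≡ g₁ - g₀
rhs-certificate-identity N J _ x ι Q X _ _ _ _ _ _ _ _ _ refl refl refl refl refl refl refl refl refl refl = solve 6 (λ N J x ι Q X →
   let c : ℕ → _
       c m = con (ℕ→ℚ m)
       o = con 1ℚ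
       sq = λ a → a :* a
       K = J :+ o
       A = N :+ K
       D₀ = J :+ J
       D₁ = D₀ :+ o
       E = K :+ K
       r = con 0ℚ :- c 2 :* (c 2 :* N :+ c 3)
       q₂ = (N :+ c 2) :* (N :+ c 2) :* (N :+ c 2)
       q₀ = (N :+ o) :* (N :+ o) :* (N :+ o)
       q₁ = (c 2 :* N :+ c 3) :* (N :* N :+ c 3 :* N :+ c 3 :+ c 2 :* x :* (x :+ o))
   in q₂ :* (sq (sq ι) :* ((A :+ o :+ o) :* ((A :+ o) :* Q)) :* X)
      :- q₁ :* (sq (sq ι) :* ((A :+ o) :* (Q :* (A :- D₀))) :* X)
      :+ q₀ :* (sq (sq ι) :* (Q :* (A :- D₀) :* (A :- D₁)) :* X)
    := r :* sq (sq ι) :* ((A :+ o) :* (Q :* (A :- D₀))) :* ((x :+ K :+ o) :* (X :* (x :+ K :- E)))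
       :- r :* sq (sq (K :* ι)) :* Q :* X) refl N J x ι Q X

module RightSide (x : ℚ) where

  term : ℕ → ℕ → ℚ
  term n k = ℕ→ℚ ((n ℕ.+ k) C (2 ℕ.* k)) * (ℕ→ℚ ((2 ℕ.* k) C k) * ℕ→ℚ ((2 ℕ.* k) C k)) * choose (x + ℕ→ℚ k) (2 ℕ.* k)

  fall2k : ℕ → ℚ
  fall2k k = fall (x + ℕ→ℚ k) (2 ℕ.* k)

  term-> : ∀ m k → m < k → term m k ≡ 0ℚ
  term-> m k m<k = begin
    ℕ→ℚ ((m ℕ.+ k) C (2 ℕ.* k)) * B * Y ≡⟨ cong (λ c → ℕ→ℚ c * B * Y) (k>n⇒nCk≡0 m+k<2k) ⟩
    0ℚ * B * Y                          ≡⟨ solve 2 (λ B Y → con 0ℚ :* B :* Y := con 0ℚ) refl B Y ⟩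
    0ℚ                                  ∎
    where B = ℕ→ℚ ((2 ℕ.* k) C k) * ℕ→ℚ ((2 ℕ.* k) C k)
          Y = choose (x + ℕ→ℚ k) (2 ℕ.* k)
          m+k<2k : m ℕ.+ k < 2 ℕ.* k
          m+k<2k = ℕₚ.<-≤-trans (ℕₚ.+-monoˡ-< k m<k) (ℕₚ.+-monoʳ-≤ k (ℕₚ.m≤m+n k 0))

  term-closed : ∀ m k → term m k ≡ (k !⁻¹ ²) ² * fall (ℕ→ℚ (m ℕ.+ k)) (2 ℕ.* k) * fall2k k
  term-closed m k = begin
    term m k
      ≡⟨ cong₂ (λ u v → u * (v * v) * choose (x + ℕ→ℚ k) (2 ℕ.* k)) (choose-ℕ→ℚ (m ℕ.+ k) (2 ℕ.* k)) (choose-ℕ→ℚ (2 ℕ.* k) k) ⟩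
    F * ι₂ * (B * k !⁻¹ * (B * k !⁻¹)) * (fall2k k * ι₂)
      ≡⟨ solve 5 (λ F ι₂ B ι X → F :* ι₂ :* (B :* ι :* (B :* ι)) :* (X :* ι₂) := (B :* ι₂ :* ι) :* (B :* ι₂ :* ι) :* F :* X)
               refl F ι₂ B (k !⁻¹) (fall2k k) ⟩
    (B * ι₂ * k !⁻¹) ² * F * fall2k k
      ≡⟨ cong (λ z → (z * k !⁻¹) ² * F * fall2k k) central ⟩
    (k !⁻¹ ²) ² * F * fall2k k ∎
    where
    F  = fall (ℕ→ℚ (m ℕ.+ k)) (2 ℕ.* k)
    B  = fall (ℕ→ℚ (2 ℕ.* k)) k
    ι₂ = (2 ℕ.* k) !⁻¹
    central : B * ι₂ ≡ k !⁻¹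
    central = trans (fall-ℕ→ℚ*!⁻¹ (ℕₚ.m≤m+n k (k ℕ.+ 0)))
                    (cong _!⁻¹ (trans (ℕₚ.m+n∸m≡n k (k ℕ.+ 0)) (ℕₚ.+-identityʳ k)))

  certificate : ℕ → ℕ → ℚ
  certificate n zero    = 0ℚ
  certificate n (suc j) = rhsFactor (ℕ→ℚ n) * (j !⁻¹ ²) ² * fall (ℕ→ℚ (n ℕ.+ suc j)) (2 ℕ.* j) * fall2k (suc j)

  certificate-end : ∀ n → certificate n (suc (suc (suc n))) ≡ 0ℚ
  certificate-end n = begin
    r * ι * fall (ℕ→ℚ (n ℕ.+ suc n₂)) (2 ℕ.* n₂) * Y ≡⟨ cong (λ z → r * ι * z * Y) (fall-ℕ→ℚ-< n+3+n<2[2+n]) ⟩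
    r * ι * 0ℚ * Y                                   ≡⟨ solve 3 (λ r ι Y → r :* ι :* con 0ℚ :* Y := con 0ℚ) refl r ι Y ⟩
    0ℚ                                               ∎
    where
    n₂ = suc (suc n)
    r  = rhsFactor (ℕ→ℚ n)
    ι  = (n₂ !⁻¹ ²) ²
    Y  = fall2k (suc n₂)
    n+3+n<2[2+n] : n ℕ.+ suc n₂ < 2 ℕ.* n₂
    n+3+n<2[2+n] = ℕₚ.≤-reflexive (trans (cong suc (ℕₚ.+-suc n n₂))
                                           (cong (λ z → suc (suc (n ℕ.+ suc (suc z)))) (sym (ℕₚ.+-identityʳ n))))

  certificate-telescopes : ∀ n k →
    recurrence x (ℕ→ℚ n) (term n k) (term (suc n) k) (term (suc (suc n)) k) ≡ certificate n (suc k) - certificate n k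
  certificate-telescopes n zero =
    trans (recurrence-cong x (ℕ→ℚ n) (term-closed n 0) (term-closed (suc n) 0) (term-closed (suc (suc n)) 0))
          (rhs-certificate-identity₀ (ℕ→ℚ n) x ((0 !⁻¹ ²) ²))
  certificate-telescopes n k@(suc j) =
    rhs-certificate-identity N J K x ι Q (fall2k k) A D₀ D₁ E _ _ _ _ _
      (ℕ→ℚ-suc j) (ℕ→ℚ-+ n k) (ℕ→ℚ-double j) (ℕ→ℚ-suc (2 ℕ.* j)) (ℕ→ℚ-double k) t₀ t₁ t₂ g₀ g₁
    where
    N  = ℕ→ℚ n
    J  = ℕ→ℚ j
    K  = ℕ→ℚ k
    ι  = k !⁻¹
    A  = ℕ→ℚ (n ℕ.+ k)
    Q  = fall A (2 ℕ.* j)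
    D₀ = ℕ→ℚ (2 ℕ.* j)
    D₁ = ℕ→ℚ (suc (2 ℕ.* j))
    E  = ℕ→ℚ (2 ℕ.* k)
    ℕ→ℚ-double : ∀ m → ℕ→ℚ (2 ℕ.* m) ≡ ℕ→ℚ m + ℕ→ℚ m
    ℕ→ℚ-double m = trans (cong (λ z → ℕ→ℚ (m ℕ.+ z)) (ℕₚ.+-identityʳ m)) (ℕ→ℚ-+ m m)
    fall-A+1 : ∀ {B} → B ≡ A + 1ℚ → fall B (2 ℕ.* k) ≡ (A + 1ℚ) * (Q * (A - D₀))
    fall-A+1 B≡A+1 = trans (cong₂ fall B≡A+1 (ℕₚ.*-suc 2 j)) (fall-+1 A (suc (2 ℕ.* j)))
    fall-A+2 : fall (ℕ→ℚ (suc (suc (n ℕ.+ k)))) (2 ℕ.* k) ≡ (A + 1ℚ + 1ℚ) * ((A + 1ℚ) * Q)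
    fall-A+2 = begin
      fall (ℕ→ℚ (suc (suc (n ℕ.+ k)))) (2 ℕ.* k)  ≡⟨ cong₂ fall (trans (ℕ→ℚ-suc (suc (n ℕ.+ k))) (cong (_+ 1ℚ) (ℕ→ℚ-suc (n ℕ.+ k))))
                                                            (ℕₚ.*-suc 2 j) ⟩
      fall (A + 1ℚ + 1ℚ) (suc (suc (2 ℕ.* j)))   ≡⟨ fall-+1 (A + 1ℚ) (suc (2 ℕ.* j)) ⟩
      (A + 1ℚ + 1ℚ) * fall (A + 1ℚ) (suc (2 ℕ.* j)) ≡⟨ cong ((A + 1ℚ + 1ℚ) *_) (fall-+1 A (2 ℕ.* j)) ⟩
      (A + 1ℚ + 1ℚ) * ((A + 1ℚ) * Q)             ∎
    t₀ : term n k ≡ (ι ²) ² * (Q * (A - D₀) * (A - D₁)) * fall2k k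
    t₀ = trans (term-closed n k) (cong (λ z → (ι ²) ² * fall A z * fall2k k) (ℕₚ.*-suc 2 j))
    t₁ : term (suc n) k ≡ (ι ²) ² * ((A + 1ℚ) * (Q * (A - D₀))) * fall2k k
    t₁ = trans (term-closed (suc n) k) (cong (λ z → (ι ²) ² * z * fall2k k) (fall-A+1 (ℕ→ℚ-suc (n ℕ.+ k))))
    t₂ : term (suc (suc n)) k ≡ (ι ²) ² * ((A + 1ℚ + 1ℚ) * ((A + 1ℚ) * Q)) * fall2k k
    t₂ = trans (term-closed (suc (suc n)) k) (cong (λ z → (ι ²) ² * z * fall2k k) fall-A+2)
    g₀ : certificate n k ≡ rhsFactor N * ((K * ι) ²) ² * Q * fall2k k
    g₀ = cong (λ z → rhsFactor N * (z ²) ² * Q * fall2k k) (!⁻¹-suc j)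
    g₁ : certificate n (suc k) ≡ rhsFactor N * (ι ²) ² * ((A + 1ℚ) * (Q * (A - D₀))) * ((x + K + 1ℚ) * (fall2k k * (x + K - E)))
    g₁ = cong₂ (λ u v → rhsFactor N * (ι ²) ² * u * v)
               (fall-A+1 (trans (cong ℕ→ℚ (ℕₚ.+-suc n k)) (ℕ→ℚ-suc (n ℕ.+ k))))
               (trans (cong₂ fall (+-ℕ→ℚ-suc x k) (ℕₚ.*-suc 2 k)) (fall-+1 (x + K) (suc (2 ℕ.* k))))

  sum-recurrence : ∀ n → recurrenceAt x (λ m → Σ[0to m ] (term m)) n ≡ 0ℚ
  sum-recurrence n = creative-telescoping x n term (certificate n) term-> (certificate-telescopes n) refl (certificate-end n)

sums-agree-at-1 : ∀ x → Σ[0to 1 ] (LeftSide.term x 1) ≡ Σ[0to 1 ] (RightSide.term x 1)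
sums-agree-at-1 = solve 1 (λ x →
   let c : ℚ → _
       c q = con q
       summandˡ = λ k → c (coeff 1 k) :* (c 1ℚ :* (x :+ c (ℕ→ℚ k) :- c (ℕ→ℚ 0)))
   in summandˡ 0 :* summandˡ 0 :+ summandˡ 1 :* summandˡ 1
      := c (ℕ→ℚ (1 C 0)) :* (c (ℕ→ℚ (0 C 0)) :* c (ℕ→ℚ (0 C 0))) :* (c 1ℚ :* c (0 !⁻¹))
         :+ c (ℕ→ℚ (2 C 2)) :* (c (ℕ→ℚ (2 C 1)) :* c (ℕ→ℚ (2 C 1)))
            :* ((c 1ℚ :* (x :+ c (ℕ→ℚ 1) :- c (ℕ→ℚ 0))) :* (x :+ c (ℕ→ℚ 1) :- c (ℕ→ℚ 1)) :* c (2 !⁻¹))) refl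

lemma2p1 : (n : ℕ) (x : ℚ) →
    Σ[0to n ] (λ k → (choose (- x + - 1ℚ) k * choose (- x + - 1ℚ) k) * (choose x (n ∸ k) * choose x (n ∸ k)))
      ≡ Σ[0to n ] (λ k → ℕ→ℚ ((n Data.Nat.+ k) C (2 Data.Nat.* k)) * (ℕ→ℚ ((2 Data.Nat.* k) C k) * ℕ→ℚ ((2 Data.Nat.* k) C k)) * choose (x + ℕ→ℚ k) (2 Data.Nat.* k))
lemma2p1 n x = trans (Σ-cong n (LeftSide.summand≡term x n))
  (recurrence-unique x (LeftSide.sum-recurrence x) (RightSide.sum-recurrence x) refl (sums-agree-at-1 x) n)
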